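{- Let $G=(V,E)$ be a simple graph on $n$ vertices. (i) If $u$ is a vertex of $G$ such that $G-u$ is a complete multi-partite graph, then $G\in\mathcal{G}$. (ii) Suppose $\{u,v\}$ is an independent set of $G$ such that $G-\{u,v\}$ is a complete multi-partite graph. If either $\{u,v\}$ is a dominating set of $G$ or $N_G(u)\cap N_G(v)=\emptyset$, then $G\in\mathcal{G}$.
   Context: $N_G(v)$ is the set of neighbours of $v$. For a simple graph $H$ whose vertex set is a set of positive integers, $\mathcal{W}(H)$ is the set of $3$-element vertex subsets $\{a,b,c\}$ with $a<b<c$ such that $ac$ is an edge and $ab$, $bc$ are non-edges. For a bijection $\omega:V(G)\to[n]$, $G_\omega$ is obtained from $G$ by relabeling each vertex $v$ as $\omega(v)$. $\mathcal{G}$ is the class of simple graphs $G$ (on any number $n$ of vertices) for which some bijection $\omega:V(G)\to[n]$ satisfies $\mathcal{W}(G_\omega)=\emptyset$. -}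

module Defs where

open import Data.Nat using (ℕ)
open import Data.Fin using (Fin; _<_)
open import Data.Product using (Σ; _×_; ∃; proj₁)
open import Data.Sum using (_⊎_)
open import Relation.Nullary using (¬_; Dec)
open import Relation.Binary.PropositionalEquality using (_≡_; _≢_)
open import Function.Bundles using (_⤖_; _⇔_; Bijection)

record Graph (n : ℕ) : Set₁ where
  field
    Adj   : Fin n → Fin n → Set
    adj?  : ∀ x y → Dec (Adj x y)
    sym   : ∀ {x y} → Adj x y → Adj y x
    irrefl : ∀ {x} → ¬ Adj x x
open Graph public

-- Relabelled graph G_ω : the vertex set is again Fin n = [n] (ordered
-- as 0 < 1 < … < n-1, i.e. label i stands for i+1), and labels i, j are
-- adjacent iff ω⁻¹ i and ω⁻¹ j are adjacent in G.
relabel : ∀ {n} → Graph n → Fin n ⤖ Fin n → Graph n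
relabel {n} G ω = record
  { Adj = λ i j → Adj G (inv i) (inv j)
  ; adj? = λ i j → adj? G (inv i) (inv j)
  ; sym = sym G
  ; irrefl = irrefl G
  }
  where
  inv : Fin n → Fin n
  inv i = proj₁ (Bijection.surjective ω i)

InW : ∀ {n} → Graph n → Fin n → Fin n → Fin n → Set
InW H a b c = (a < b) × (b < c) × Adj H a c × ¬ Adj H a b × ¬ Adj H b c

WEmpty : ∀ {n} → Graph n → Set
WEmpty H = ∀ a b c → ¬ InW H a b c

InClassG : ∀ {n} → Graph n → Set
InClassG {n} G = Σ (Fin n ⤖ Fin n) λ ω → WEmpty (relabel G ω)

CompleteMultipartiteOn : ∀ {n} → Graph n → (Fin n → Set) → Set
CompleteMultipartiteOn {n} G S =
  Σ (Fin n → ℕ) λ part →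
    ∀ x y → S x → S y → x ≢ y → (Adj G x y ⇔ part x ≢ part y)

DeleteOneCM : ∀ {n} → Graph n → Fin n → Set
DeleteOneCM G u = CompleteMultipartiteOn G (λ x → x ≢ u)

DeleteTwoCM : ∀ {n} → Graph n → Fin n → Fin n → Set
DeleteTwoCM G u v = CompleteMultipartiteOn G (λ x → x ≢ u × x ≢ v)

IndependentPair : ∀ {n} → Graph n → Fin n → Fin n → Set
IndependentPair G u v = u ≢ v × ¬ Adj G u v

DominatingPair : ∀ {n} → Graph n → Fin n → Fin n → Set
DominatingPair G u v = ∀ w → w ≡ u ⊎ w ≡ v ⊎ Adj G w u ⊎ Adj G w v

DisjointNeighbourhoods : ∀ {n} → Graph n → Fin n → Fin n → Set
DisjointNeighbourhoods G u v = ∀ w → ¬ (Adj G u w × Adj G v w)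

-- Order the vertices by a "level" so that the exceptional vertices sit at the
-- ends.  For (i): u first, then N(u), then the rest.  For (ii): u first, then
-- N(u) \ N(v), then the vertices adjacent to both or to neither of u and v,
-- then N(v) \ N(u), and v last; the hypothesis on {u,v} says that the middle
-- block is of only one of its two kinds.  Inside a complete multipartite graph
-- non-adjacency of distinct vertices is an equivalence relation, so a 𝒲-triple
-- (x z an edge, y adjacent to neither) cannot lie entirely there, and one
-- checks that a triple meeting u or v cannot be ordered by level.

module Submission where

open import Defs renaming (sym to Adj-sym)
open import Data.Nat using (ℕ; _≤_; s≤s)
import Data.Nat.Properties as ℕ
open import Data.Fin as Fin using (Fin; cast; _≟_)
open import Data.Fin.Properties using (cast-involutive; toℕ-cast)
open import Data.Fin.Permutation using (Permutation; _⟨$⟩ʳ_; _∘ₚ_; cast-id; flip)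
open import Data.List using (length; lookup; allFin)
open import Data.List.Properties using (length-tabulate; lookup-tabulate)
import Data.List.Sort as Sort
open import Data.List.Relation.Unary.Sorted.TotalOrder.Properties using (lookup-mono-≤)
open import Data.List.Relation.Binary.Permutation.Propositional using (↭⇒↭ₛ)
import Data.List.Relation.Binary.Permutation.Setoid as Permutationₛ
import Data.List.Relation.Binary.Permutation.Setoid.Properties as Permutationₛ
open import Data.Product using (Σ; _×_; _,_; proj₁)
open import Data.Sum using (_⊎_; inj₁; inj₂)
open import Data.Empty using (⊥-elim)
open import Function using (id; _∘_)
open import Function.Bundles using (_⤖_; _⇔_; mk⇔; Bijection; Equivalence)
open import Function.Properties.Inverse using (↔⇒⤖)
import Relation.Binary.Construct.On as On
open import Relation.Binary.Bundles using (DecTotalOrder)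
open import Relation.Binary.PropositionalEquality
  using (_≡_; _≢_; refl; sym; trans; cong; subst₂; setoid; module ≡-Reasoning)
open import Relation.Nullary using (¬_; yes; no)
open import Relation.Nullary.Decidable using (decidable-stable)

-- The inverse used by `relabel`: label i of G_ω is the vertex vertexAt ω i.
vertexAt : ∀ {n} → Fin n ⤖ Fin n → Fin n → Fin n
vertexAt ω i = proj₁ (Bijection.surjective ω i)

lookup-allFin : ∀ {n} (k : Fin (length (allFin n))) →
                lookup (allFin n) k ≡ cast (length-tabulate {n = n} id) k
lookup-allFin {n} k = begin
  lookup (allFin n) k
    ≡⟨ cong (lookup (allFin n)) (sym (cast-involutive (sym |allFin|) |allFin| k)) ⟩
  lookup (allFin n) (cast (sym |allFin|) (cast |allFin| k))
    ≡⟨ lookup-tabulate id (cast |allFin| k) ⟩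
  cast |allFin| k ∎
  where
  open ≡-Reasoning
  |allFin| : length (allFin n) ≡ n
  |allFin| = length-tabulate id

-- Merge-sort the vertices by key; the permutation underlying `sort xs ↭ xs`
-- is the required relabelling.
sortingBijection : ∀ {n} (key : Fin n → ℕ) →
  Σ (Fin n ⤖ Fin n) λ ω → ∀ {i j} → i Fin.≤ j → key (vertexAt ω i) ≤ key (vertexAt ω j)
sortingBijection {n} key = ↔⇒⤖ (flip σ) , λ {i} {j} i≤j →
  subst₂ _≤_ (cong key (lookup-sorted i)) (cong key (lookup-sorted j))
    (lookup-mono-≤ totalOrder (sort-↗ (allFin n))
      (subst₂ _≤_ (sym (toℕ-cast |sorted| i)) (sym (toℕ-cast |sorted| j)) i≤j))
  where
  byKey : DecTotalOrder _ _ _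
  byKey = On.decTotalOrder ℕ.≤-decTotalOrder key
  open DecTotalOrder byKey using (totalOrder)
  open Sort byKey using (sort; sort-↭; sort-↗)

  sorted↭ : Permutationₛ._↭_ (setoid (Fin n)) (sort (allFin n)) (allFin n)
  sorted↭ = ↭⇒↭ₛ (sort-↭ (allFin n))

  |sorted| : n ≡ length (sort (allFin n))
  |sorted| = trans (sym (length-tabulate id))
                   (sym (Permutationₛ.xs↭ys⇒|xs|≡|ys| (setoid (Fin n)) sorted↭))

  σ : Permutation n n
  σ = cast-id |sorted| ∘ₚ Permutationₛ.onIndices sorted↭ ∘ₚ cast-id (length-tabulate id)

  lookup-sorted : ∀ i → lookup (sort (allFin n)) (cast |sorted| i) ≡ σ ⟨$⟩ʳ i
  lookup-sorted i = trans (Permutationₛ.onIndices-lookup (setoid (Fin n)) sorted↭ _)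
                          (lookup-allFin _)

module _ {n : ℕ} (G : Graph n) where

  WTriple : Fin n → Fin n → Fin n → Set
  WTriple x y z = Adj G x z × ¬ Adj G x y × ¬ Adj G y z

  WTriple-x≢y : ∀ {x y z} → WTriple x y z → x ≢ y
  WTriple-x≢y (x∼z , _ , y≁z) refl = y≁z x∼z

  WTriple-y≢z : ∀ {x y z} → WTriple x y z → y ≢ z
  WTriple-y≢z (x∼z , x≁y , _) refl = x≁y x∼z

  WTriple-x≢z : ∀ {x y z} → WTriple x y z → x ≢ z
  WTriple-x≢z (x∼z , _) refl = irrefl G x∼z

  NoMonotoneWTriple : (Fin n → ℕ) → Set
  NoMonotoneWTriple key = ∀ x y z → key x ≤ key y → key y ≤ key z → ¬ WTriple x y z

  noMonotoneWTriple⇒inClassG : ∀ key → NoMonotoneWTriple key → InClassG G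
  noMonotoneWTriple⇒inClassG key free =
    let ω , sorted = sortingBijection key
    in ω , λ a b c (a<b , b<c , w) → free _ _ _ (sorted (ℕ.<⇒≤ a<b)) (sorted (ℕ.<⇒≤ b<c)) w

  completeMultipartite⇒noWTriple : ∀ {S} → CompleteMultipartiteOn G S →
    ∀ {x y z} → S x → S y → S z → ¬ WTriple x y z
  completeMultipartite⇒noWTriple {S} (part , cm) sx sy sz w@(x∼z , x≁y , y≁z) =
    Equivalence.to (cm _ _ sx sz (WTriple-x≢z w)) x∼z
      (trans (samePart sx sy (WTriple-x≢y w) x≁y) (samePart sy sz (WTriple-y≢z w) y≁z))
    where
    samePart : ∀ {a b} → S a → S b → a ≢ b → ¬ Adj G a b → part a ≡ part b
    samePart sa sb a≢b a≁b =
      decidable-stable (part _ ℕ.≟ part _) (a≁b ∘ Equivalence.from (cm _ _ sa sb a≢b))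

module DeletingOneVertex {n : ℕ} (G : Graph n) (u : Fin n) where

  -- Opaque, so that the `with`s on `_ ≟ u` in `levelOrder` do not abstract inside `level`.
  opaque
    level : Fin n → ℕ
    level w with w ≟ u | adj? G u w
    ... | yes _ | _     = 0
    ... | no _  | yes _ = 1
    ... | no _  | no _  = 2

  opaque
    unfolding level

    levelBelow-u : ∀ {w} → level w ≤ level u → w ≡ u
    levelBelow-u {w} w≤u = level≤0⇒≡u (ℕ.≤-trans w≤u (ℕ.≤-reflexive level-u))
      where
      level-u : level u ≡ 0
      level-u with u ≟ u
      ... | yes _   = refl
      ... | no u≢u = ⊥-elim (u≢u refl)

      level≤0⇒≡u : level w ≤ 0 → w ≡ u
      level≤0⇒≡u _  with w ≟ u | adj? G u w
      level≤0⇒≡u _  | yes w≡u | _     = w≡u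
      level≤0⇒≡u () | no _    | yes _
      level≤0⇒≡u () | no _    | no _

    level≤1⇔adjacent : ∀ {w} → w ≢ u → level w ≤ 1 ⇔ Adj G u w
    level≤1⇔adjacent {w} w≢u with w ≟ u | adj? G u w
    ... | yes w≡u | _       = ⊥-elim (w≢u w≡u)
    ... | no _    | yes u∼w = mk⇔ (λ _ → u∼w) (λ _ → ℕ.≤-refl)
    ... | no _    | no u≁w  = mk⇔ (λ { (s≤s ()) }) (⊥-elim ∘ u≁w)

  levelOrder : DeleteOneCM G u → NoMonotoneWTriple G level
  levelOrder cm x y z x≤y y≤z w@(x∼z , x≁y , _) with y ≟ u | z ≟ u | x ≟ u
  ... | yes refl | _        | _        = WTriple-x≢y G w (levelBelow-u x≤y)
  ... | no y≢u   | yes refl | _        = y≢u (levelBelow-u y≤z)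
  ... | no y≢u   | no z≢u   | yes refl =
    x≁y (Equivalence.to (level≤1⇔adjacent y≢u)
          (ℕ.≤-trans y≤z (Equivalence.from (level≤1⇔adjacent z≢u) x∼z)))
  ... | no y≢u   | no z≢u   | no x≢u   = completeMultipartite⇒noWTriple G cm x≢u y≢u z≢u w

module DeletingIndependentPair {n : ℕ} (G : Graph n) (u v : Fin n) where

  opaque
    level : Fin n → ℕ
    level w with w ≟ u | w ≟ v | adj? G u w | adj? G v w
    ... | yes _ | _     | _     | _     = 0
    ... | no _  | yes _ | _     | _     = 4
    ... | no _  | no _  | yes _ | no _  = 1
    ... | no _  | no _  | no _  | yes _ = 3
    ... | no _  | no _  | _     | _     = 2

  opaque
    unfolding level

    levelBelow-u : ∀ {w} → level w ≤ level u → w ≡ u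
    levelBelow-u {w} w≤u = level≤0⇒≡u (ℕ.≤-trans w≤u (ℕ.≤-reflexive level-u))
      where
      level-u : level u ≡ 0
      level-u with u ≟ u
      ... | yes _   = refl
      ... | no u≢u = ⊥-elim (u≢u refl)

      level≤0⇒≡u : level w ≤ 0 → w ≡ u
      level≤0⇒≡u _  with w ≟ u | w ≟ v | adj? G u w | adj? G v w
      level≤0⇒≡u _  | yes w≡u | _     | _     | _     = w≡u
      level≤0⇒≡u () | no _    | yes _ | _     | _
      level≤0⇒≡u () | no _    | no _  | yes _ | no _
      level≤0⇒≡u () | no _    | no _  | no _  | yes _
      level≤0⇒≡u () | no _    | no _  | yes _ | yes _
      level≤0⇒≡u () | no _    | no _  | no _  | no _

    levelAbove-v : u ≢ v → ∀ {w} → level v ≤ level w → w ≡ v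
    levelAbove-v u≢v {w} v≤w = 4≤level⇒≡v (ℕ.≤-trans (ℕ.≤-reflexive (sym level-v)) v≤w)
      where
      level-v : level v ≡ 4
      level-v with v ≟ u | v ≟ v
      ... | yes v≡u | _       = ⊥-elim (u≢v (sym v≡u))
      ... | no _    | yes _   = refl
      ... | no _    | no v≢v = ⊥-elim (v≢v refl)

      4≤level⇒≡v : 4 ≤ level w → w ≡ v
      4≤level⇒≡v _ with w ≟ u | w ≟ v | adj? G u w | adj? G v w
      4≤level⇒≡v () | yes _ | _       | _     | _
      4≤level⇒≡v _  | no _  | yes w≡v | _     | _     = w≡v
      4≤level⇒≡v (s≤s ())             | no _  | no _  | yes _ | no _
      4≤level⇒≡v (s≤s (s≤s (s≤s ()))) | no _  | no _  | no _  | yes _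
      4≤level⇒≡v (s≤s (s≤s ()))       | no _  | no _  | yes _ | yes _
      4≤level⇒≡v (s≤s (s≤s ()))       | no _  | no _  | no _  | no _

    level≤2⇔ : ∀ {w} → w ≢ u → w ≢ v → level w ≤ 2 ⇔ (Adj G v w → Adj G u w)
    level≤2⇔ {w} w≢u w≢v with w ≟ u | w ≟ v | adj? G u w | adj? G v w
    ... | yes w≡u | _       | _       | _       = ⊥-elim (w≢u w≡u)
    ... | no _    | yes w≡v | _       | _       = ⊥-elim (w≢v w≡v)
    ... | no _    | no _    | yes u∼w | no _    = mk⇔ (λ _ _ → u∼w) (λ _ → ℕ.n≤1+n 1)
    ... | no _    | no _    | no u≁w  | yes v∼w = mk⇔ (λ { (s≤s (s≤s ())) }) (λ f → ⊥-elim (u≁w (f v∼w)))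
    ... | no _    | no _    | yes u∼w | yes _   = mk⇔ (λ _ _ → u∼w) (λ _ → ℕ.≤-refl)
    ... | no _    | no _    | no _    | no v≁w  = mk⇔ (λ _ → ⊥-elim ∘ v≁w) (λ _ → ℕ.≤-refl)

    2≤level⇔ : ∀ {w} → w ≢ u → w ≢ v → 2 ≤ level w ⇔ (Adj G u w → Adj G v w)
    2≤level⇔ {w} w≢u w≢v with w ≟ u | w ≟ v | adj? G u w | adj? G v w
    ... | yes w≡u | _       | _       | _       = ⊥-elim (w≢u w≡u)
    ... | no _    | yes w≡v | _       | _       = ⊥-elim (w≢v w≡v)
    ... | no _    | no _    | yes u∼w | no v≁w  = mk⇔ (λ { (s≤s ()) }) (λ f → ⊥-elim (v≁w (f u∼w)))
    ... | no _    | no _    | no _    | yes v∼w = mk⇔ (λ _ _ → v∼w) (λ _ → ℕ.n≤1+n 2)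
    ... | no _    | no _    | yes _   | yes v∼w = mk⇔ (λ _ _ → v∼w) (λ _ → ℕ.≤-refl)
    ... | no _    | no _    | no u≁w  | no _    = mk⇔ (λ _ → ⊥-elim ∘ u≁w) (λ _ → ℕ.≤-refl)

  squeezed⇒balanced : ∀ {p q} → p ≢ u → p ≢ v → q ≢ u → q ≢ v → level p ≤ level q →
    (Adj G u p → Adj G v p) → (Adj G v q → Adj G u q) →
    (Adj G v p → Adj G u p) × (Adj G u q → Adj G v q)
  squeezed⇒balanced p≢u p≢v q≢u q≢v p≤q 2≤p q≤2 =
    Equivalence.to (level≤2⇔ p≢u p≢v)
      (ℕ.≤-trans p≤q (Equivalence.from (level≤2⇔ q≢u q≢v) q≤2)) ,
    Equivalence.to (2≤level⇔ q≢u q≢v)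
      (ℕ.≤-trans (Equivalence.from (2≤level⇔ p≢u p≢v) 2≤p) p≤q)

  undominated⇒noCommonNeighbour : DominatingPair G u v ⊎ DisjointNeighbourhoods G u v →
    ∀ {y} → y ≢ u → y ≢ v → ¬ Adj G u y → ¬ Adj G v y →
    ∀ {z} → ¬ (Adj G u z × Adj G v z)
  undominated⇒noCommonNeighbour (inj₂ disjoint) _ _ _ _ {z} = disjoint z
  undominated⇒noCommonNeighbour (inj₁ dominating) {y} y≢u y≢v u≁y v≁y _ with dominating y
  ... | inj₁ y≡u               = y≢u y≡u
  ... | inj₂ (inj₁ y≡v)        = y≢v y≡v
  ... | inj₂ (inj₂ (inj₁ y∼u)) = u≁y (Adj-sym G y∼u)
  ... | inj₂ (inj₂ (inj₂ y∼v)) = v≁y (Adj-sym G y∼v)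

  levelOrder : IndependentPair G u v → DeleteTwoCM G u v →
    DominatingPair G u v ⊎ DisjointNeighbourhoods G u v → NoMonotoneWTriple G level
  levelOrder (u≢v , u≁v) cm hyp x y z x≤y y≤z w@(x∼z , x≁y , y≁z)
    with y ≟ u | y ≟ v | z ≟ u | x ≟ v | x ≟ u | z ≟ v
  ... | yes refl | _      | _        | _        | _        | _        =
    WTriple-x≢y G w (levelBelow-u x≤y)
  ... | no _     | yes refl | _      | _        | _        | _        =
    WTriple-y≢z G w (sym (levelAbove-v u≢v y≤z))
  ... | no y≢u   | no _   | yes refl | _        | _        | _        = y≢u (levelBelow-u y≤z)
  ... | no _     | no y≢v | no _     | yes refl | _        | _        = y≢v (levelAbove-v u≢v x≤y)
  ... | no _     | no _   | no _     | no _     | yes refl | yes refl = u≁v x∼z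
  ... | no y≢u   | no y≢v | no z≢u   | no _     | yes refl | no z≢v   =
    let v∼y⇒u∼y , u∼z⇒v∼z = squeezed⇒balanced y≢u y≢v z≢u z≢v y≤z (⊥-elim ∘ x≁y) (λ _ → x∼z)
    in undominated⇒noCommonNeighbour hyp y≢u y≢v x≁y (x≁y ∘ v∼y⇒u∼y) (x∼z , u∼z⇒v∼z x∼z)
  ... | no y≢u   | no y≢v | no _     | no x≢v   | no x≢u   | yes refl =
    let z∼x = Adj-sym G x∼z
        z≁y = y≁z ∘ Adj-sym G
        z∼x⇒u∼x , u∼y⇒z∼y = squeezed⇒balanced x≢u x≢v y≢u y≢v x≤y (λ _ → z∼x) (⊥-elim ∘ z≁y)
    in undominated⇒noCommonNeighbour hyp y≢u y≢v (z≁y ∘ u∼y⇒z∼y) z≁y (z∼x⇒u∼x z∼x , z∼x)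
  ... | no y≢u   | no y≢v | no z≢u   | no x≢v   | no x≢u   | no z≢v   =
    completeMultipartite⇒noWTriple G cm (x≢u , x≢v) (y≢u , y≢v) (z≢u , z≢v) w

proposition5p4 : ∀ (n : ℕ) (G : Graph n) →
    ((u : Fin n) → DeleteOneCM G u → InClassG G)
    × ((u v : Fin n) → IndependentPair G u v → DeleteTwoCM G u v →
        DominatingPair G u v ⊎ DisjointNeighbourhoods G u v → InClassG G)
proposition5p4 n G =
  (λ u cm → noMonotoneWTriple⇒inClassG G _ (DeletingOneVertex.levelOrder G u cm)) ,
  (λ u v independent cm hyp →
     noMonotoneWTriple⇒inClassG G _ (DeletingIndependentPair.levelOrder G u v independent cm hyp))
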